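{- If $e_I$ is not admissible, then there exist indices $s < w$ such that $e_{i_s} e_{i_w}$ is not admissible.
   Context: Let $k$ be a commutative ring with unity. The vertices of the hypercube $Q_n$ are identified with $[2^n]=\{0,1,\ldots,2^n-1\}$ via binary expansion, and $d_H$ denotes Hamming distance. The Vietoris--Rips complex $VR(Q_n;r)$ is the clique complex of the graph on $Q_n$ with $a,b$ adjacent iff $d_H(a,b)\le r$; its Stanley--Reisner ring is $k[x_0,\ldots,x_{2^n-1}]/\mathcal{I}$, where $\mathcal{I}$ is generated by the quadratic monomials $x_ax_b$ with $a<b$, $d_H(a,b)>r$. These monomial generators are ordered by: $x_ax_b<x_cx_d$ if $d_H(a,b)<d_H(c,d)$, and lexicographically if $d_H(a,b)=d_H(c,d)$. Write $m_1<m_2<\cdots$ for the generators in this order, and let the Taylor complex be $k[x_0,\ldots,x_{2^n-1}]\otimes\Lambda(e_1,e_2,\ldots)$ with $e_i$ corresponding to $m_i$ (also written $e_{(a,b)}$ for $m_i=x_ax_b$). For $I=(i_1,\ldots,i_t)$ with $i_1<\cdots<i_t$, the generator $e_I=e_{i_1}\cdots e_{i_t}$ is called admissible if for every $1\le h\le t$ and every index $q>i_h$, the monomial $m_q$ does not divide $\operatorname{lcm}(m_{i_1},\ldots,m_{i_h})$. -}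

module Defs where

open import Data.Nat using (ℕ; zero; suc; _+_; _^_; _⊔_; _≤_) renaming (_<_ to _<ℕ_)
open import Data.Nat.DivMod using (_/_; _%_)
open import Data.Fin using (Fin; toℕ; _≟_) renaming (_<_ to _<F_)
open import Data.Bool using (if_then_else_)
open import Relation.Nullary using (¬_; does)
open import Relation.Binary.PropositionalEquality using (_≡_)
open import Data.Product using (_×_)
open import Data.Sum using (_⊎_)
open import Data.List using (List; []; _∷_; foldr; length; lookup; take)
open import Data.Nat using () renaming (_≟_ to _≟ℕ_)

hamming : ℕ → ℕ → ℕ → ℕ
hamming zero    a b = 0
hamming (suc k) a b =
  (if does (a % 2 ≟ℕ b % 2) then 0 else 1) + hamming k (a / 2) (b / 2)

Vertex : ℕ → Set
Vertex n = Fin (2 ^ n)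

dH : (n : ℕ) → Vertex n → Vertex n → ℕ
dH n a b = hamming n (toℕ a) (toℕ b)

-- Generators x_a x_b of the Stanley–Reisner ideal of VR(Q_n; r):
-- a < b and d_H(a,b) > r.
record Gen (n r : ℕ) : Set where
  constructor gen
  field
    a    : Vertex n
    b    : Vertex n
    a<b  : a <F b
    far  : r <ℕ dH n a b
open Gen public

_<G_ : {n r : ℕ} → Gen n r → Gen n r → Set
_<G_ {n} g h =
  (dH n (a g) (b g) <ℕ dH n (a h) (b h)) ⊎
  ((dH n (a g) (b g) ≡ dH n (a h) (b h)) ×
    ((toℕ (a g) <ℕ toℕ (a h)) ⊎
     ((toℕ (a g) ≡ toℕ (a h)) × (toℕ (b g) <ℕ toℕ (b h)))))

Monomial : ℕ → Set
Monomial n = Vertex n → ℕ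

_∣ₘ_ : {n : ℕ} → Monomial n → Monomial n → Set
_∣ₘ_ {n} m m' = (v : Vertex n) → m v ≤ m' v

lcmₘ : {n : ℕ} → Monomial n → Monomial n → Monomial n
lcmₘ m m' v = m v ⊔ m' v

oneₘ : {n : ℕ} → Monomial n
oneₘ v = 0

mono : {n r : ℕ} → Gen n r → Monomial n
mono g v = (if does (v ≟ a g) then 1 else 0) + (if does (v ≟ b g) then 1 else 0)

lcmList : {n r : ℕ} → List (Gen n r) → Monomial n
lcmList {n} = foldr (λ g m → lcmₘ {n} (mono g) m) (oneₘ {n})

-- Here h ranges over Fin t (0-based), so the prefix is take (h+1) I.
Admissible : {n r : ℕ} → List (Gen n r) → Set
Admissible {n} {r} I =
  (h : Fin (length I)) (q : Gen n r) →
  lookup I h <G q → ¬ (_∣ₘ_ {n} (mono q) (lcmList (take (suc (toℕ h)) I)))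

module Submission where

open import Defs
open import Data.Nat using (ℕ)
open import Data.Fin using (Fin) renaming (_<_ to _<F_)
open import Data.List using (List; []; _∷_; length; lookup)
open import Data.List.Relation.Unary.AllPairs using (AllPairs)
open import Data.Product using (Σ; _×_)
open import Relation.Nullary using (¬_)

open import Data.Nat using (suc; _<_; z≤n; s≤s) renaming (_<?_ to _<ℕ?_; _≟_ to _≟ℕ_)
open import Data.Nat.Properties
  using (≤-trans; <-trans; <-irrefl; <-asym; <-resp₂-≡; ⊔-sel; m≤m⊔n; m≤n⊔m; m<1+n⇒m<n∨m≡n)
open import Data.Fin using (toℕ; _≟_) renaming (zero to fzero; suc to fsuc; _<?_ to _<F?_)
open import Data.Fin.Properties using (any?; <-cmp; toℕ-injective)
open import Data.List using (take)
open import Data.List.Membership.Propositional.Properties using (∈-lookup)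
import Data.List.Relation.Unary.All as All
open import Data.List.Relation.Unary.AllPairs using (_∷_)
open import Data.Product using (_,_)
open import Data.Product.Relation.Binary.Pointwise.NonDependent using (Pointwise)
open import Data.Product.Relation.Binary.Lex.Strict using (×-Lex; ×-transitive; ×-irreflexive; ×-decidable)
open import Data.Sum using (_⊎_; inj₁; inj₂; [_,_]′)
open import Data.Empty using (⊥-elim)
open import Level using (0ℓ)
open import Relation.Binary using (Rel; Transitive; Irreflexive; tri<; tri≈; tri>)
open import Relation.Binary.PropositionalEquality
  using (_≡_; _≢_; refl; sym; trans; cong; cong₂; subst; subst₂; isEquivalence)
open import Relation.Nullary using (Dec; yes; no)
open import Relation.Nullary.Decidable using (_×-dec_)

-- If m_q divides lcm(m_{i_1}, …, m_{i_h}) with q > i_h, then each of the two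
-- variables of the squarefree m_q = x_a x_b divides some m_{i_j} with j ≤ h.
-- The two indices differ, since a generator is determined by its two
-- variables; so for the smaller index s and the larger w, m_q already
-- divides lcm(m_{i_s}, m_{i_w}) and q > i_h ≥ i_w.  Constructively, the
-- pair (s, w) together with the endpoints of q is found by a finite search.

AllPairs-lookup : ∀ {a ℓ} {A : Set a} {R : Rel A ℓ} {xs : List A} → AllPairs R xs →
  (i j : Fin (length xs)) → i <F j → R (lookup xs i) (lookup xs j)
AllPairs-lookup {xs = x ∷ xs} (x≺xs ∷ _) fzero (fsuc j) _ = All.lookup x≺xs (∈-lookup j)
AllPairs-lookup (_ ∷ sorted) (fsuc i) (fsuc j) (s≤s i<j) = AllPairs-lookup sorted i j i<j

module _ {n r : ℕ} where

  _∈ᵍ_ : Vertex n → Gen n r → Set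
  v ∈ᵍ g = v ≡ a g ⊎ v ≡ b g

  a≢b : (g : Gen n r) → a g ≢ b g
  a≢b g a≡b = <-irrefl (cong toℕ a≡b) (a<b g)

  ∈ᵍ⇒mono-pos : {v : Vertex n} {g : Gen n r} → v ∈ᵍ g → 0 < mono g v
  ∈ᵍ⇒mono-pos {v} {g} v∈g with v ≟ a g | v ≟ b g
  ... | yes _   | _       = s≤s z≤n
  ... | no _    | yes _   = s≤s z≤n
  ... | no v≢a  | no v≢b  = ⊥-elim ([ v≢a , v≢b ]′ v∈g)

  mono-pos⇒∈ᵍ : {v : Vertex n} {g : Gen n r} → 0 < mono g v → v ∈ᵍ g
  mono-pos⇒∈ᵍ {v} {g} pos with v ≟ a g | v ≟ b g
  ... | yes v≡a | _       = inj₁ v≡a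
  ... | no _    | yes v≡b = inj₂ v≡b

  mono-∣ₘ : (q : Gen n r) (m : Monomial n) → 0 < m (a q) → 0 < m (b q) → _∣ₘ_ {n} (mono q) m
  mono-∣ₘ q m a-pos b-pos v with v ≟ a q | v ≟ b q
  ... | yes refl | yes v≡b = ⊥-elim (a≢b q v≡b)
  ... | yes refl | no _    = a-pos
  ... | no _     | yes refl = b-pos
  ... | no _     | no _    = z≤n

  lcmList-pos : (L : List (Gen n r)) (j : Fin (length L)) {v : Vertex n} →
    v ∈ᵍ lookup L j → 0 < lcmList L v
  lcmList-pos (g ∷ L) fzero    v∈g = ≤-trans (∈ᵍ⇒mono-pos {g = g} v∈g) (m≤m⊔n _ _)
  lcmList-pos (g ∷ L) (fsuc j) v∈g = ≤-trans (lcmList-pos L j v∈g) (m≤n⊔m _ _)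

  lcmList-take-pos⇒∈ᵍ : (L : List (Gen n r)) (m : ℕ) (v : Vertex n) →
    0 < lcmList (take m L) v → Σ (Fin (length L)) λ j → (toℕ j < m) × v ∈ᵍ lookup L j
  lcmList-take-pos⇒∈ᵍ (g ∷ L) (suc m) v pos with ⊔-sel (mono g v) (lcmList (take m L) v)
  ... | inj₁ lcm≡g = fzero , s≤s z≤n , mono-pos⇒∈ᵍ {g = g} (subst (0 <_) lcm≡g pos)
  ... | inj₂ lcm≡L with lcmList-take-pos⇒∈ᵍ L m v (subst (0 <_) lcm≡L pos)
  ...   | j , j<m , v∈ = fsuc j , s≤s j<m , v∈

  -- g <G h unfolds definitionally to key g <ᵏ key h.
  key : Gen n r → ℕ × ℕ × ℕ
  key g = dH n (a g) (b g) , toℕ (a g) , toℕ (b g)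

  _<ᵏ_ : Rel (ℕ × ℕ × ℕ) 0ℓ
  _<ᵏ_ = ×-Lex _≡_ _<_ (×-Lex _≡_ _<_ _<_)

  <ᵏ-trans : Transitive _<ᵏ_
  <ᵏ-trans = ×-transitive {_≈₁_ = _≡_} {_<₁_ = _<_} {_<₂_ = ×-Lex _≡_ _<_ _<_}
               isEquivalence <-resp₂-≡ <-trans
               (×-transitive {_≈₁_ = _≡_} {_<₁_ = _<_} {_<₂_ = _<_} isEquivalence <-resp₂-≡ <-trans <-trans)

  <ᵏ-irrefl : Irreflexive (Pointwise _≡_ (Pointwise _≡_ _≡_)) _<ᵏ_
  <ᵏ-irrefl = ×-irreflexive {_≈₁_ = _≡_} {_<₁_ = _<_} {_≈₂_ = Pointwise _≡_ _≡_} {_<₂_ = ×-Lex _≡_ _<_ _<_}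
    <-irrefl (×-irreflexive {_≈₁_ = _≡_} {_<₁_ = _<_} {_≈₂_ = _≡_} {_<₂_ = _<_} <-irrefl <-irrefl)

  <G-trans : {g h k : Gen n r} → g <G h → h <G k → g <G k
  <G-trans {g} {h} {k} = <ᵏ-trans {key g} {key h} {key k}

  ≡-endpoints⇒¬<G : {g q : Gen n r} → a q ≡ a g → b q ≡ b g → ¬ g <G q
  ≡-endpoints⇒¬<G {g} {q} aq≡ag bq≡bg =
    <ᵏ-irrefl {key g} {key q}
      (cong₂ (dH n) (sym aq≡ag) (sym bq≡bg) , cong toℕ (sym aq≡ag) , cong toℕ (sym bq≡bg))

  endpoints∈ᵍ⇒¬<G : {g q : Gen n r} → a q ∈ᵍ g → b q ∈ᵍ g → ¬ g <G q
  endpoints∈ᵍ⇒¬<G {g} {q} (inj₁ aq≡ag) (inj₂ bq≡bg) = ≡-endpoints⇒¬<G {g} {q} aq≡ag bq≡bg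
  endpoints∈ᵍ⇒¬<G {q = q} (inj₁ aq≡ag) (inj₁ bq≡ag) _ = a≢b q (trans aq≡ag (sym bq≡ag))
  endpoints∈ᵍ⇒¬<G {q = q} (inj₂ aq≡bg) (inj₂ bq≡bg) _ = a≢b q (trans aq≡bg (sym bq≡bg))
  endpoints∈ᵍ⇒¬<G {g} {q} (inj₂ aq≡bg) (inj₁ bq≡ag) _ =
    <-asym (a<b g) (subst₂ (λ x y → toℕ y < toℕ x) bq≡ag aq≡bg (a<b q))

  sorted-<G : {I : List (Gen n r)} → AllPairs _<G_ I → (i h : Fin (length I)) {q : Gen n r} →
    toℕ i < suc (toℕ h) → lookup I h <G q → lookup I i <G q
  sorted-<G {I} sorted i h {q} i≤h h<q with m<1+n⇒m<n∨m≡n i≤h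
  ... | inj₁ i<h = <G-trans {lookup I i} {lookup I h} {q} (AllPairs-lookup sorted i h i<h) h<q
  ... | inj₂ i≡h = subst (λ k → lookup I k <G q) (sym (toℕ-injective i≡h)) h<q

  -- Generators above g, indexed by their endpoints so that they can be searched for.
  GenAbove : Gen n r → Vertex n → Vertex n → Set
  GenAbove g x y = (x <F y) × (r < dH n x y) × key g <ᵏ (dH n x y , toℕ x , toℕ y)

  genAbove? : (g : Gen n r) (x y : Vertex n) → Dec (GenAbove g x y)
  genAbove? g x y = (x <F? y) ×-dec (r <ℕ? dH n x y) ×-dec
    ×-decidable _≟ℕ_ _<ℕ?_ (×-decidable _≟ℕ_ _<ℕ?_ _<ℕ?_) (key g) _

  PairObstruction : Gen n r → Gen n r → Set
  PairObstruction g h = Σ (Vertex n) λ x → Σ (Vertex n) λ y →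
    GenAbove h x y × 0 < lcmList (g ∷ h ∷ []) x × 0 < lcmList (g ∷ h ∷ []) y

  pairObstruction? : (g h : Gen n r) → Dec (PairObstruction g h)
  pairObstruction? g h = any? λ x → any? λ y →
    genAbove? h x y ×-dec (0 <ℕ? lcmList (g ∷ h ∷ []) x) ×-dec (0 <ℕ? lcmList (g ∷ h ∷ []) y)

  pairObstruction⇒¬Admissible : {g h : Gen n r} → PairObstruction g h → ¬ Admissible (g ∷ h ∷ [])
  pairObstruction⇒¬Admissible {g} {h} (x , y , (x<y , far , h<q) , x-pos , y-pos) adm =
    adm (fsuc fzero) q h<q (mono-∣ₘ q (lcmList (g ∷ h ∷ [])) x-pos y-pos)
    where
    q : Gen n r
    q = gen x y x<y far

  Obstruction : List (Gen n r) → Set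
  Obstruction I = Σ (Fin (length I)) λ s → Σ (Fin (length I)) λ w →
    (s <F w) × PairObstruction (lookup I s) (lookup I w)

  obstruction? : (I : List (Gen n r)) → Dec (Obstruction I)
  obstruction? I = any? λ s → any? λ w → (s <F? w) ×-dec pairObstruction? (lookup I s) (lookup I w)

  divisor⇒obstruction : {I : List (Gen n r)} → AllPairs _<G_ I →
    (h : Fin (length I)) (q : Gen n r) → lookup I h <G q →
    _∣ₘ_ {n} (mono q) (lcmList (take (suc (toℕ h)) I)) → Obstruction I
  divisor⇒obstruction {I} sorted h q h<q q∣
    with lcmList-take-pos⇒∈ᵍ I _ (a q) (≤-trans (∈ᵍ⇒mono-pos {g = q} (inj₁ refl)) (q∣ (a q)))
       | lcmList-take-pos⇒∈ᵍ I _ (b q) (≤-trans (∈ᵍ⇒mono-pos {g = q} (inj₂ refl)) (q∣ (b q)))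
  ... | j , j≤h , aq∈ | k , k≤h , bq∈ with <-cmp j k
  ...   | tri< j<k _ _ = j , k , j<k , a q , b q , (a<b q , far q , sorted-<G {I} sorted k h {q} k≤h h<q) ,
                           lcmList-pos (lookup I j ∷ lookup I k ∷ []) fzero aq∈ ,
                           lcmList-pos (lookup I j ∷ lookup I k ∷ []) (fsuc fzero) bq∈
  ...   | tri> _ _ k<j = k , j , k<j , a q , b q , (a<b q , far q , sorted-<G {I} sorted j h {q} j≤h h<q) ,
                           lcmList-pos (lookup I k ∷ lookup I j ∷ []) (fsuc fzero) aq∈ ,
                           lcmList-pos (lookup I k ∷ lookup I j ∷ []) fzero bq∈
  ...   | tri≈ _ refl _ = ⊥-elim (endpoints∈ᵍ⇒¬<G {lookup I j} {q} aq∈ bq∈ (sorted-<G {I} sorted j h {q} j≤h h<q))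

mainTheorem5 : (n r : ℕ) (I : List (Gen n r)) → AllPairs _<G_ I →
    ¬ Admissible I →
    Σ (Fin (length I)) λ s → Σ (Fin (length I)) λ w →
      (s <F w) × ¬ Admissible (lookup I s ∷ lookup I w ∷ [])
mainTheorem5 n r I sorted ¬adm with obstruction? I
... | yes (s , w , s<w , obstructed) = s , w , s<w , pairObstruction⇒¬Admissible obstructed
... | no ¬obstructed = ⊥-elim (¬adm λ h q h<q q∣ → ¬obstructed (divisor⇒obstruction sorted h q h<q q∣))
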